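{- Let $t\ge 1$ and $n$ be integers with $2t<n$, and let $A\subseteq\{0,1\}^n$ be a Steiner system with parameters $(n,t+1,t)$. Then $A$ is a covering array of strength $t$ but not a covering array of strength $t+1$.
   Context: A set $A=\{x^1,\dots,x^m\}\subseteq\{0,1\}^n$ is a Steiner system with parameters $(n,q,t)$ if every $x^i$ has exactly $q$ entries equal to $1$, and for every set of indices $I=\{i_1,\dots,i_t\}\subseteq[n]$ there is a unique $x^j\in A$ with $x^j_{i_\ell}=1$ for all $\ell=1,\dots,t$. A set $S\subseteq\{0,1\}^n$ is a covering array of strength $k$ if for every $I=\{i_1,\dots,i_k\}\subseteq[n]$ of size $k$ and every $a\in\{0,1\}^k$ there exists $x\in S$ with $(x_{i_1},\dots,x_{i_k})=a$. -}

module Defs where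

open import Data.Nat using (ℕ; zero; suc; _+_)
open import Data.Bool using (Bool; true; false)
open import Data.Fin using (Fin)
open import Data.Vec using (Vec; []; _∷_; lookup; map)
open import Data.Product using (Σ; _×_; ∃)
open import Relation.Binary.PropositionalEquality using (_≡_)
open import Function.Definitions using (Injective)

BinVec : ℕ → Set
BinVec n = Vec Bool n

ones : ∀ {n} → BinVec n → ℕ
ones [] = 0
ones (true ∷ xs) = suc (ones xs)
ones (false ∷ xs) = ones xs

IndexSet : ℕ → ℕ → Set
IndexSet n k = Σ (Vec (Fin n) k) (λ is → Injective _≡_ _≡_ (lookup is))

indices : ∀ {n k} → IndexSet n k → Vec (Fin n) k
indices (is Data.Product., _) = is

restrict : ∀ {n k} → BinVec n → IndexSet n k → Vec Bool k
restrict x I = map (lookup x) (indices I)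

allOnesOn : ∀ {n k} → BinVec n → IndexSet n k → Set
allOnesOn {k = k} x I = (ℓ : Fin k) → lookup x (lookup (indices I) ℓ) ≡ true

SteinerSystem : (n q t : ℕ) → (BinVec n → Set) → Set
SteinerSystem n q t A =
  ((x : BinVec n) → A x → ones x ≡ q) ×
  ((I : IndexSet n t) →
     Σ (BinVec n) (λ x → A x × allOnesOn x I ×
        ((y : BinVec n) → A y → allOnesOn y I → y ≡ x)))

CoveringArray : (n k : ℕ) → (BinVec n → Set) → Set
CoveringArray n k S =
  (I : IndexSet n k) → (a : Vec Bool k) →
    Σ (BinVec n) (λ x → S x × restrict x I ≡ a)

-- A block of a Steiner system with parameters (n, t+1, t) has exactly t+1 points and is determined
-- by any t of them, so no t-set K lies in two blocks that extend it by two different points e, u: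
-- they would coincide and then hold the t+2 points of K ∪ {e, u}. Strength t+1 fails at once, since
-- the blocks realizing all ones on K ∪ {e} and on K ∪ {u} are such a pair.
-- For strength t, let T and F be the positions where the pattern is 1 and 0, and take |F|+1 indices
-- D outside the index set (n > 2t leaves room). For m ∈ D the block B_m through T ∪ (D ∖ {m})
-- realizes the pattern unless it meets F. If every B_m meets F, by pigeonhole two of them, B_m and
-- B_m′, meet it in the same point φ; then both contain the t-set T ∪ (D ∖ {m, m′}) ∪ {φ} and extend
-- it by m′ and by m respectively, which is impossible.

module Submission where

open import Defs
open import Data.Bool using (Bool; true; false; if_then_else_)
open import Data.Bool.Properties using () renaming (_≟_ to _≟ᵇ_)
open import Data.Empty using (⊥; ⊥-elim)
open import Data.Fin using (Fin; zero; suc; inject≤; punchIn)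
open import Data.Fin.Properties
  using ( _≟_; suc-injective; inject≤-injective; punchIn-injective; punchInᵢ≢i; any?
        ; injective⇒≤; <⇒notInjective)
open import Data.Nat using (ℕ; zero; suc; _+_; _*_; _≤_; _<_)
import Data.Nat.Properties as ℕ
open import Data.Product using (_×_; _,_; proj₁; proj₂; ∃; ∃-syntax)
open import Data.Sum using (_⊎_; inj₁; inj₂)
open import Data.Unit using (⊤; tt)
open import Data.Vec as Vec using (Vec; lookup; tabulate; replicate)
open import Data.Vec.Properties
  using (lookup-map; lookup∘tabulate; tabulate∘lookup; tabulate-cong; lookup-replicate)
open import Data.Vec.Functional using (_∷_; updateAt)
open import Data.Vec.Functional.Properties using (updateAt-updates; updateAt-minimal)
open import Function using (_∘_; const)
open import Function.Definitions using (Injective)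
open import Relation.Binary.PropositionalEquality
open import Relation.Nullary using (¬_; Dec; yes; no; contradiction)
open import Relation.Nullary.Decidable using (¬?; _×-dec_; decidable-stable)

private variable
  k n t : ℕ

Distinct : (Fin k → Fin n) → Set
Distinct = Injective _≡_ _≡_

_∉_ : Fin n → (Fin k → Fin n) → Set
e ∉ K = ∀ i → K i ≢ e

OnesAt : BinVec n → (Fin k → Fin n) → Set
OnesAt x K = ∀ i → lookup x (K i) ≡ true

∷-distinct : {e : Fin n} {K : Fin k → Fin n} → e ∉ K → Distinct K → Distinct (e ∷ K)
∷-distinct e∉K K! {zero}  {zero}  _  = refl
∷-distinct e∉K K! {zero}  {suc j} eq = contradiction (sym eq) (e∉K j)
∷-distinct e∉K K! {suc i} {zero}  eq = contradiction eq (e∉K i)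
∷-distinct e∉K K! {suc i} {suc j} eq = cong suc (K! eq)

_[_]≔_ : {A : Set} → (Fin k → A) → Fin k → A → (Fin k → A)
K [ q ]≔ v = updateAt K q (const v)

[]≔-view : {A : Set} (K : Fin k → A) (q : Fin k) (v : A) (p : Fin k) →
  (p ≡ q × (K [ q ]≔ v) p ≡ v) ⊎ (p ≢ q × (K [ q ]≔ v) p ≡ K p)
[]≔-view K q v p with p ≟ q
... | yes refl = inj₁ (refl , updateAt-updates p K)
... | no p≢q  = inj₂ (p≢q , updateAt-minimal p q K p≢q)

[]≔-elim : {A : Set} (P : A → Set) {K : Fin k → A} {q : Fin k} {v : A} →
  P v → (∀ p → p ≢ q → P (K p)) → ∀ p → P ((K [ q ]≔ v) p)
[]≔-elim P {K} {q} {v} Pv PK p with []≔-view K q v p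
... | inj₁ (_ , Kp≡v)   = subst P (sym Kp≡v) Pv
... | inj₂ (p≢q , Kp≡) = subst P (sym Kp≡) (PK p p≢q)

[]≔-distinct : {K : Fin k → Fin n} {q : Fin k} {v : Fin n} →
  Distinct K → v ∉ K → Distinct (K [ q ]≔ v)
[]≔-distinct {K = K} {q} {v} K! v∉K {i} {j} eq with []≔-view K q v i | []≔-view K q v j
... | inj₁ (refl , _)  | inj₁ (refl , _)  = refl
... | inj₁ (_ , ≡v)    | inj₂ (_ , ≡Kj)   = contradiction (trans (sym ≡Kj) (trans (sym eq) ≡v)) (v∉K j)
... | inj₂ (_ , ≡Ki)   | inj₁ (_ , ≡v)    = contradiction (trans (sym ≡Ki) (trans eq ≡v)) (v∉K i)
... | inj₂ (_ , ≡Ki)   | inj₂ (_ , ≡Kj)   = K! (trans (sym ≡Ki) (trans eq ≡Kj))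

avoiding-family : ∀ k → t + k ≤ n → (f : Fin t → Fin n) →
  ∃ λ (d : Fin k → Fin n) → Distinct d × (∀ c → d c ∉ f)
avoiding-family {t = zero} k k≤n f = (λ c → inject≤ c k≤n) , inject≤-injective k≤n k≤n _ _ , λ _ ()
avoiding-family {suc t} {n} k 1+t+k≤n f
  with d , d! , d∉f ← avoiding-family (suc k) (subst (_≤ n) (sym (ℕ.+-suc t k)) 1+t+k≤n) (f ∘ suc)
  with any? (λ c → d c ≟ f zero)
... | yes (c , dc≡f₀) = d ∘ punchIn c , punchIn-injective c _ _ ∘ d! , fresh
  where
  fresh : ∀ i → d (punchIn c i) ∉ f
  fresh i zero    f₀≡d = punchInᵢ≢i c i (d! (trans (sym f₀≡d) (sym dc≡f₀)))
  fresh i (suc j) = d∉f (punchIn c i) j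
... | no f₀∉d = d ∘ suc , suc-injective ∘ d! , fresh
  where
  fresh : ∀ i → d (suc i) ∉ f
  fresh i zero    f₀≡d = f₀∉d (suc i , sym f₀≡d)
  fresh i (suc j) = d∉f (suc i) j

rank : (x : BinVec n) (i : Fin n) → lookup x i ≡ true → Fin (ones x)
rank (true  Vec.∷ x) zero    _  = zero
rank (true  Vec.∷ x) (suc i) xi = suc (rank x i xi)
rank (false Vec.∷ x) (suc i) xi = rank x i xi

rank-injective : (x : BinVec n) {i j : Fin n} {xi : lookup x i ≡ true} {xj : lookup x j ≡ true} →
  rank x i xi ≡ rank x j xj → i ≡ j
rank-injective (true  Vec.∷ x) {zero}  {zero}  _  = refl
rank-injective (true  Vec.∷ x) {suc i} {suc j} eq = cong suc (rank-injective x (suc-injective eq))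
rank-injective (false Vec.∷ x) {suc i} {suc j} eq = cong suc (rank-injective x eq)

distinct-onesAt⇒≤ones : {x : BinVec n} {K : Fin k → Fin n} → Distinct K → OnesAt x K → k ≤ ones x
distinct-onesAt⇒≤ones {x = x} {K} K! xK =
  injective⇒≤ {f = λ i → rank x (K i) (xK i)} (K! ∘ rank-injective x)

indexSet : (K : Fin k → Fin n) → Distinct K → IndexSet n k
indexSet K K! = tabulate K , λ {i} {j} eq →
  K! (trans (sym (lookup∘tabulate K i)) (trans eq (lookup∘tabulate K j)))

onesAt⇒allOnesOn : {x : BinVec n} {K : Fin k → Fin n} (K! : Distinct K) →
  OnesAt x K → allOnesOn x (indexSet K K!)
onesAt⇒allOnesOn {x = x} {K} _ xK i = subst (λ j → lookup x j ≡ true) (sym (lookup∘tabulate K i)) (xK i)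

allOnesOn⇒onesAt : {x : BinVec n} {K : Fin k → Fin n} (K! : Distinct K) →
  allOnesOn x (indexSet K K!) → OnesAt x K
allOnesOn⇒onesAt {x = x} {K} _ xK i = subst (λ j → lookup x j ≡ true) (lookup∘tabulate K i) (xK i)

restrict⇒lookup : {x : BinVec n} (I : IndexSet n k) {a : Vec Bool k} →
  restrict x I ≡ a → ∀ i → lookup x (lookup (indices I) i) ≡ lookup a i
restrict⇒lookup {x = x} I eq i =
  trans (sym (lookup-map i (lookup x) (indices I))) (cong (λ v → lookup v i) eq)

lookup⇒restrict : {x : BinVec n} (I : IndexSet n k) {a : Vec Bool k} →
  (∀ i → lookup x (lookup (indices I) i) ≡ lookup a i) → restrict x I ≡ a
lookup⇒restrict {x = x} I {a} xI≗a = begin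
  restrict x I                      ≡⟨ tabulate∘lookup (restrict x I) ⟨
  tabulate (lookup (restrict x I))  ≡⟨ tabulate-cong restrict≗a ⟩
  tabulate (lookup a)               ≡⟨ tabulate∘lookup a ⟩
  a                                 ∎
  where
  open ≡-Reasoning
  restrict≗a : ∀ i → lookup (restrict x I) i ≡ lookup a i
  restrict≗a i = trans (lookup-map i (lookup x) (indices I)) (xI≗a i)

coveringArray⇒onesAt : {A : BinVec n → Set} → CoveringArray n k A →
  (K : Fin k → Fin n) → Distinct K → ∃[ x ] A x × OnesAt x K
coveringArray⇒onesAt {k = k} cov K K! with x , Ax , xK≡1 ← cov (indexSet K K!) (replicate k true) =
  x , Ax , λ i → trans (allOnes i) (lookup-replicate i true)
  where
  allOnes : ∀ i → lookup x (K i) ≡ lookup (replicate k true) i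
  allOnes i = subst (λ j → lookup x j ≡ _) (lookup∘tabulate K i)
                    (restrict⇒lookup {x = x} (indexSet K K!) xK≡1 i)

module Relabelling (α : Fin t → Bool) where

  -- Indexes the fresh points D: one more than the zeros of α.
  Pool : Fin (suc t) → Set
  Pool zero    = ⊤
  Pool (suc p) = α p ≡ false

  -- For m in the pool, relabel m maps the zeros of α onto the rest of the pool (relabel-onto).
  relabel : Fin (suc t) → Fin t → Fin (suc t)
  relabel zero    p = suc p
  relabel (suc m) p with p ≟ m
  ... | yes _ = zero
  ... | no  _ = suc p

  relabel-at : (m : Fin t) → relabel (suc m) m ≡ zero
  relabel-at m with m ≟ m
  ... | yes _   = refl
  ... | no  m≢m = contradiction refl m≢m

  relabel-off : {m p : Fin t} → p ≢ m → relabel (suc m) p ≡ suc p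
  relabel-off {m} {p} p≢m with p ≟ m
  ... | yes p≡m = contradiction p≡m p≢m
  ... | no  _   = refl

  relabel-injective : ∀ m → Distinct (relabel m)
  relabel-injective zero eq = suc-injective eq
  relabel-injective (suc m) {p} {p′} eq with p ≟ m | p′ ≟ m
  ... | yes p≡m | yes p′≡m = trans p≡m (sym p′≡m)
  ... | no  _   | no  _    = suc-injective eq

  relabel-≢ : ∀ m p → relabel m p ≢ m
  relabel-≢ zero    p ()
  relabel-≢ (suc m) p eq with p ≟ m
  relabel-≢ (suc m) p () | yes _
  ... | no p≢m = p≢m (suc-injective eq)

  relabel-pool : ∀ m {p} → α p ≡ false → Pool (relabel m p)
  relabel-pool zero    αp = αp
  relabel-pool (suc m) {p} αp with p ≟ m
  ... | yes _ = tt
  ... | no  _ = αp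

  relabel-onto : {m j : Fin (suc t)} → Pool m → Pool j → j ≢ m →
    ∃[ p ] α p ≡ false × relabel m p ≡ j
  relabel-onto {zero}  {zero}  _  _  0≢0 = contradiction refl 0≢0
  relabel-onto {zero}  {suc p} _  αp _   = p , αp , refl
  relabel-onto {suc m} {zero}  αm _  _   = m , αm , relabel-at m
  relabel-onto {suc m} {suc p} _  αp j≢m = p , αp , relabel-off (j≢m ∘ cong suc)

  pool-pigeonhole : (φ : Fin (suc t) → Fin t) → (∀ {m} → Pool m → α (φ m) ≡ false) →
    (∀ {m m′} → Pool m → Pool m′ → φ m ≡ φ m′ → m ≡ m′) → ⊥
  pool-pigeonhole φ φ-zero φ-injective = <⇒notInjective (ℕ.n<1+n _) E-injective
    where
    -- E agrees with φ on the pool and sends every other suc p to p, a one of α that φ never hits.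
    E : Fin (suc t) → Fin t
    E zero    = φ zero
    E (suc p) = if α p then p else φ (suc p)

    E-injective : Distinct E
    E-injective {zero} {zero} _ = refl
    E-injective {zero} {suc p′} eq with α p′ in αp′
    ... | true  = contradiction (trans (sym (φ-zero tt)) (trans (cong α eq) αp′)) λ ()
    ... | false = φ-injective tt αp′ eq
    E-injective {suc p} {zero} eq with α p in αp
    ... | true  = contradiction (trans (sym (φ-zero tt)) (trans (cong α (sym eq)) αp)) λ ()
    ... | false = φ-injective αp tt eq
    E-injective {suc p} {suc p′} eq with α p in αp | α p′ in αp′
    ... | true  | true  = cong suc eq
    ... | true  | false = contradiction (trans (sym (φ-zero αp′)) (trans (cong α (sym eq)) αp)) λ ()
    ... | false | true  = contradiction (trans (sym (φ-zero αp)) (trans (cong α eq) αp′)) λ ()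
    ... | false | false = φ-injective αp αp′ eq

module SteinerBlocks {A : BinVec n → Set} (S : SteinerSystem n (suc t) t A) where

  block-through : (K : Fin t → Fin n) → Distinct K → ∃[ x ] A x × OnesAt x K
  block-through K K! with x , Ax , xK , _ ← proj₂ S (indexSet K K!) =
    x , Ax , allOnesOn⇒onesAt {x = x} K! xK

  block-unique : {K : Fin t → Fin n} {x y : BinVec n} → Distinct K →
    A x → A y → OnesAt x K → OnesAt y K → x ≡ y
  block-unique {K} {x} {y} K! Ax Ay xK yK =
    trans (unique x Ax (onesAt⇒allOnesOn {x = x} K! xK))
          (sym (unique y Ay (onesAt⇒allOnesOn {x = y} K! yK)))
    where unique = proj₂ (proj₂ (proj₂ (proj₂ S (indexSet K K!))))

  block-size : {K : Fin k → Fin n} {x : BinVec n} → A x → Distinct K → OnesAt x K → k ≤ suc t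
  block-size {x = x} Ax K! xK = subst (_ ≤_) (proj₁ S x Ax) (distinct-onesAt⇒≤ones {x = x} K! xK)

  no-two-extensions : {K : Fin t → Fin n} {e u : Fin n} {x y : BinVec n} →
    Distinct K → e ∉ K → u ∉ K → e ≢ u → A x → A y → OnesAt x (e ∷ K) → OnesAt y (u ∷ K) → ⊥
  no-two-extensions {K} {e} {u} {x} {y} K! e∉K u∉K e≢u Ax Ay xeK yuK =
    ℕ.1+n≰n (block-size {x = x} Ax (∷-distinct e∉uK (∷-distinct u∉K K!)) xeuK)
    where
    x≡y : x ≡ y
    x≡y = block-unique K! Ax Ay (xeK ∘ suc) (yuK ∘ suc)
    e∉uK : e ∉ (u ∷ K)
    e∉uK zero    = e≢u ∘ sym
    e∉uK (suc i) = e∉K i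
    xeuK : OnesAt x (e ∷ u ∷ K)
    xeuK zero          = xeK zero
    xeuK (suc zero)    = subst (λ z → lookup z u ≡ true) (sym x≡y) (yuK zero)
    xeuK (suc (suc i)) = xeK (suc i)

  ¬coveringArray-suc : 2 + t ≤ n → ¬ CoveringArray n (suc t) A
  ¬coveringArray-suc 2+t≤n cov =
    let _ , Ax , xeK = coveringArray⇒onesAt cov (e ∷ K) (∷-distinct e∉K K!)
        _ , Ay , yuK = coveringArray⇒onesAt cov (u ∷ K) (∷-distinct u∉K K!)
    in  no-two-extensions K! e∉K u∉K e≢u Ax Ay xeK yuK
    where
    g : Fin (2 + t) → Fin n
    g i = inject≤ i 2+t≤n
    g! : Distinct g
    g! = inject≤-injective 2+t≤n 2+t≤n _ _
    e u : Fin n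
    e = g zero
    u = g (suc zero)
    K : Fin t → Fin n
    K i = g (suc (suc i))
    K! : Distinct K
    K! = suc-injective ∘ suc-injective ∘ g!
    e∉K : e ∉ K
    e∉K i = (λ ()) ∘ g!
    u∉K : u ∉ K
    u∉K i = (λ ()) ∘ g!
    e≢u : e ≢ u
    e≢u = (λ ()) ∘ g!

  module Realization {f : Fin t → Fin n} (f! : Distinct f) (α : Fin t → Bool)
                     {d : Fin (suc t) → Fin n} (d! : Distinct d) (d∉f : ∀ c → d c ∉ f) where
    open Relabelling α

    K : Fin (suc t) → Fin t → Fin n
    K m p = if α p then f p else d (relabel m p)

    K-one : ∀ m {p} → α p ≡ true → K m p ≡ f p
    K-one m {p} αp = cong (λ b → if b then f p else d (relabel m p)) αp

    K-zero : ∀ m {p} → α p ≡ false → K m p ≡ d (relabel m p)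
    K-zero m {p} αp = cong (λ b → if b then f p else d (relabel m p)) αp

    K-distinct : ∀ m → Distinct (K m)
    K-distinct m {p} {p′} eq with α p | α p′
    ... | true  | true  = f! eq
    ... | true  | false = contradiction eq (d∉f _ p)
    ... | false | true  = contradiction (sym eq) (d∉f _ p′)
    ... | false | false = relabel-injective m (d! eq)

    zero-∉-K : ∀ m {r} → α r ≡ false → f r ∉ K m
    zero-∉-K m {r} αr p eq with α p in αp
    ... | true  = contradiction (trans (sym αp) (trans (cong α (f! eq)) αr)) λ ()
    ... | false = d∉f _ r (sym eq)

    pool-∉-K : ∀ m → d m ∉ K m
    pool-∉-K m p eq with α p
    ... | true  = d∉f m p eq
    ... | false = relabel-≢ m p (d! eq)

    B : Fin (suc t) → BinVec n
    B m = proj₁ (block-through (K m) (K-distinct m))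

    B-block : ∀ m → A (B m)
    B-block m = proj₁ (proj₂ (block-through (K m) (K-distinct m)))

    B-K : ∀ m → OnesAt (B m) (K m)
    B-K m = proj₂ (proj₂ (block-through (K m) (K-distinct m)))

    B-one : ∀ {m p} → α p ≡ true → lookup (B m) (f p) ≡ true
    B-one {m} {p} αp = subst (λ i → lookup (B m) i ≡ true) (K-one m αp) (B-K m p)

    B-pool : ∀ {m j} → Pool m → Pool j → j ≢ m → lookup (B m) (d j) ≡ true
    B-pool {m} pm pj j≢m with p , αp , p↦j ← relabel-onto pm pj j≢m =
      subst (λ i → lookup (B m) i ≡ true) (trans (K-zero m αp) (cong d p↦j)) (B-K m p)

    B-K-elsewhere : ∀ {m′} → Pool m′ → ∀ m p → relabel m p ≢ m′ → lookup (B m′) (K m p) ≡ true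
    B-K-elsewhere pm′ m p p↦̸m′ with α p in αp
    ... | true  = B-one αp
    ... | false = B-pool pm′ (relabel-pool m αp) p↦̸m′

    Misses : Fin (suc t) → Set
    Misses m = ∃[ r ] α r ≡ false × lookup (B m) (f r) ≡ true

    Misses? : ∀ m → Dec (Misses m)
    Misses? m = any? λ r → (α r ≟ᵇ false) ×-dec (lookup (B m) (f r) ≟ᵇ true)

    ¬misses⇒realizes : ∀ {m} → ¬ Misses m → ∀ p → lookup (B m) (f p) ≡ α p
    ¬misses⇒realizes {m} ¬misses p with α p in αp | lookup (B m) (f p) in Bp
    ... | true  | _     = trans (sym Bp) (B-one αp)
    ... | false | true  = contradiction (p , αp , Bp) ¬misses
    ... | false | false = refl

    misses-distinct : ∀ {m m′ r} → Pool m → Pool m′ → m ≢ m′ → α r ≡ false →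
      lookup (B m) (f r) ≡ true → lookup (B m′) (f r) ≡ true → ⊥
    -- Replacing d m′ by f r in K m gives a t-set lying in both blocks, which B m extends by d m′
    -- and B m′ by d m.
    misses-distinct {m} {m′} {r} pm pm′ m≢m′ αr Bm∋fr Bm′∋fr
      with q , αq , q↦m′ ← relabel-onto pm pm′ (m≢m′ ∘ sym) =
      no-two-extensions K′! dm′∉K′ dm∉K′ (m≢m′ ∘ sym ∘ d!) (B-block m) (B-block m′) Bm∋ Bm′∋
      where
      K′ : Fin t → Fin n
      K′ = K m [ q ]≔ f r
      K′! : Distinct K′
      K′! = []≔-distinct (K-distinct m) (zero-∉-K m αr)
      Kmq≡dm′ : K m q ≡ d m′
      Kmq≡dm′ = trans (K-zero m αq) (cong d q↦m′)
      dm′∉K′ : d m′ ∉ K′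
      dm′∉K′ = []≔-elim (_≢ d m′) (d∉f m′ r)
        (λ p p≢q Kmp≡dm′ → p≢q (K-distinct m (trans Kmp≡dm′ (sym Kmq≡dm′))))
      dm∉K′ : d m ∉ K′
      dm∉K′ = []≔-elim (_≢ d m) (d∉f m r) (λ p _ → pool-∉-K m p)
      Bm∋ : OnesAt (B m) (d m′ ∷ K′)
      Bm∋ zero    = subst (λ i → lookup (B m) i ≡ true) Kmq≡dm′ (B-K m q)
      Bm∋ (suc i) = []≔-elim (λ j → lookup (B m) j ≡ true) Bm∋fr (λ p _ → B-K m p) i
      Bm′∋ : OnesAt (B m′) (d m ∷ K′)
      Bm′∋ zero    = B-pool pm′ pm m≢m′
      Bm′∋ (suc i) = []≔-elim (λ j → lookup (B m′) j ≡ true) Bm′∋fr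
        (λ p p≢q → B-K-elsewhere pm′ m p λ p↦m′ →
                     p≢q (relabel-injective m (trans p↦m′ (sym q↦m′)))) i

    realizes : ∃[ x ] A x × (∀ p → lookup x (f p) ≡ α p)
    realizes with any? (λ m → ¬? (Misses? m))
    ... | yes (m , ¬misses) = B m , B-block m , ¬misses⇒realizes ¬misses
    ... | no ¬∃¬misses = ⊥-elim (pool-pigeonhole φ φ-zero φ-injective)
      where
      misses : ∀ m → Misses m
      misses m = decidable-stable (Misses? m) (¬∃¬misses ∘ (m ,_))
      φ : Fin (suc t) → Fin t
      φ m = proj₁ (misses m)
      φ-zero : ∀ {m} → Pool m → α (φ m) ≡ false
      φ-zero {m} _ = proj₁ (proj₂ (misses m))
      φ-injective : ∀ {m m′} → Pool m → Pool m′ → φ m ≡ φ m′ → m ≡ m′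
      φ-injective {m} {m′} pm pm′ φm≡φm′ with m ≟ m′
      ... | yes m≡m′ = m≡m′
      ... | no  m≢m′ = ⊥-elim (misses-distinct pm pm′ m≢m′ (φ-zero pm) (proj₂ (proj₂ (misses m)))
                         (subst (λ r → lookup (B m′) (f r) ≡ true) (sym φm≡φm′)
                                (proj₂ (proj₂ (misses m′)))))

  coveringArray : t + suc t ≤ n → CoveringArray n t A
  coveringArray t+1+t≤n I@(is , is!) a =
    let d , d! , d∉f = avoiding-family (suc t) t+1+t≤n (lookup is)
        x , Ax , x≗a = Realization.realizes is! (lookup a) d! d∉f
    in  x , Ax , lookup⇒restrict {x = x} I x≗a

lemma3p2 : (t n : ℕ) → 1 ≤ t → 2 * t < n → (A : BinVec n → Set) →
    SteinerSystem n (suc t) t A →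
    CoveringArray n t A × ¬ CoveringArray n (suc t) A
lemma3p2 t n 1≤t 2t<n A S = coveringArray t+1+t≤n , ¬coveringArray-suc 2+t≤n
  where
  open SteinerBlocks S
  t+1+t≤n : t + suc t ≤ n
  t+1+t≤n = subst (_≤ n) (trans (cong (λ s → suc (t + s)) (ℕ.+-identityʳ t)) (sym (ℕ.+-suc t t)))
                  2t<n
  2+t≤n : 2 + t ≤ n
  2+t≤n = ℕ.≤-trans (ℕ.+-monoˡ-≤ (suc t) 1≤t) t+1+t≤n
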